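{- Let $G$ be any weighted graph, $s$ and $t$ positive integers, and $x_i \in V(G)$. Let $G_{i,s}'$ be the weighted graph obtained from $G$ by adding one new vertex $x'$ and a single edge $x_i x'$ of weight $s$. Then $\pi_{st}(G, x_i) = \pi_t(G_{i,s}', x')$.
   Context: A weighted graph is a finite undirected graph $G$ with a function $w: E(G) \to \mathbb{N}^+$. A distribution is a function from the vertex set to $\mathbb{N}$ (numbers of pebbles). A pebbling move along an edge $e = xx'$ removes $w(e)$ pebbles from $x$ and places one pebble on $x'$. For a vertex $v$ and positive integer $t$, $\pi_t(G,v)$ is the smallest number $N$ such that from every distribution with at least $N$ pebbles, a sequence of pebbling moves yields a distribution with at least $t$ pebbles on $v$ ($\infty$ if no such $N$ exists). -}

module Defs where

open import Data.Nat using (ℕ; zero; suc; _+_; _∸_; _≤_; _<_)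
open import Data.Fin using (Fin; zero; suc)
open import Data.Fin.Properties using (_≟_)
open import Data.Product using (Σ; _×_; _,_; ∃-syntax)
open import Relation.Nullary using (yes; no)
open import Relation.Binary.PropositionalEquality using (_≡_; refl)
open import Function.Bundles using (_⇔_)

-- A finite undirected weighted (simple) graph on vertex set Fin n.
-- weight u v = 0 encodes "no edge uv"; weight u v = k > 0 encodes an
-- edge uv of weight k ∈ ℕ⁺.
record WGraph (n : ℕ) : Set where
  field
    weight    : Fin n → Fin n → ℕ
    symmetric : ∀ u v → weight u v ≡ weight v u
    loopless  : ∀ v → weight v v ≡ 0
open WGraph public

Distribution : ℕ → Set
Distribution n = Fin n → ℕ

total : ∀ {n} → Distribution n → ℕ
total {zero}  D = 0
total {suc n} D = D zero + total (λ i → D (suc i))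

at : ∀ {n} → Fin n → ℕ → Fin n → ℕ
at x a z with z ≟ x
... | yes _ = a
... | no  _ = 0

moveDist : ∀ {n} → ℕ → Fin n → Fin n → Distribution n → Distribution n
moveDist w x y D z = (D z ∸ at x w z) + at y 1 z

data Reach {n} (G : WGraph n) : Distribution n → Distribution n → Set where
  done : ∀ {D} → Reach G D D
  step : ∀ {D E} (x y : Fin n) →
         0 < weight G x y →
         weight G x y ≤ D x →
         Reach G (moveDist (weight G x y) x y D) E →
         Reach G D E

Solvable : ∀ {n} → WGraph n → Fin n → ℕ → ℕ → Set
Solvable G v t N =
  ∀ (D : Distribution _) → N ≤ total D →
    ∃[ E ] (Reach G D E × t ≤ E v)

-- "π_t(G,v) = N": N is the smallest number with the Solvable property.
-- (π_t(G,v) = ∞ iff IsPebblingNumber G v t N holds for no N.)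
IsPebblingNumber : ∀ {n} → WGraph n → Fin n → ℕ → ℕ → Set
IsPebblingNumber G v t N =
  Solvable G v t N × (∀ M → Solvable G v t M → N ≤ M)

-- G'_{x,s}: add a new vertex x' (= zero) and one edge x x' of weight s.
-- Old vertices v are embedded as suc v.
extWeight : ∀ {n} → WGraph n → Fin n → ℕ → Fin (suc n) → Fin (suc n) → ℕ
extWeight G x s zero    zero    = 0
extWeight G x s zero    (suc j) = at x s j
extWeight G x s (suc i) zero    = at x s i
extWeight G x s (suc i) (suc j) = weight G i j

extSym : ∀ {n} (G : WGraph n) x s u v → extWeight G x s u v ≡ extWeight G x s v u
extSym G x s zero    zero    = refl
extSym G x s zero    (suc j) = refl
extSym G x s (suc i) zero    = refl
extSym G x s (suc i) (suc j) = symmetric G i j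

extLoop : ∀ {n} (G : WGraph n) x s v → extWeight G x s v v ≡ 0
extLoop G x s zero    = refl
extLoop G x s (suc i) = loopless G i

extend : ∀ {n} → WGraph n → Fin n → ℕ → WGraph (suc n)
extend G x s = record
  { weight    = extWeight G x s
  ; symmetric = extSym G x s
  ; loopless  = extLoop G x s }

newVertex : ∀ {n} → Fin (suc n)
newVertex = zero

-- Both pebbling numbers are "the least N with property Solvable", so it is
-- enough to show, for every M,  Solvable G x (s·t) M ⇔ Solvable G' x' t M.
--
-- (⇐) A distribution D of G is a distribution of G' with x' empty.  A G'-move
--   sequence is replayed in G while keeping the invariant 'Covers': the
--   G-distribution dominates every old vertex, and on x it dominates
--   (pebbles on x) + s·(pebbles on x').  Moves across the new edge only trade
--   s pebbles on x for one on x' (or lose pebbles), so t pebbles on x' yield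
--   s·t on x.
-- (⇒) Given a G'-distribution with a pebbles on x', put s·a "borrowed"
--   pebbles on x instead.  This G-distribution has at least as many pebbles,
--   so it reaches s·t pebbles on x.  The borrowing lemma replays that move
--   sequence without the borrowed pebbles, ending with at most s·a fewer
--   pebbles on x; it lifts to G', and the remaining s·(t ∸ a) pebbles on x
--   are pushed across the new edge, giving t pebbles on x'.
module Submission where

open import Defs
open import Data.Nat using (ℕ; zero; suc; _+_; _*_; _∸_; _≤_; _<_; z≤n; _≤?_)
open import Data.Nat.Properties hiding (_≟_)
open import Data.Fin using (Fin; zero; suc)
open import Data.Fin.Properties using (_≟_)
open import Data.Product using (_×_; _,_; ∃-syntax)
open import Relation.Nullary using (yes; no; contradiction)
open import Relation.Binary.PropositionalEquality
open import Function.Bundles using (_⇔_; mk⇔; Equivalence)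
open import Algebra.Properties.CommutativeSemigroup +-commutativeSemigroup
  using (interchange; xy∙z≈xz∙y)

at-self : ∀ {n} (u : Fin n) k → at u k u ≡ k
at-self u k with u ≟ u
... | yes _  = refl
... | no u≢u = contradiction refl u≢u

at-suc : ∀ {n} (u : Fin n) k z → at (suc u) k (suc z) ≡ at u k z
at-suc u k z with z ≟ u
... | yes _ = refl
... | no  _ = refl

at-suc-self : ∀ {n} (u : Fin n) k → at (suc u) k (suc u) ≡ k
at-suc-self u k = trans (at-suc u k u) (at-self u k)

at-support : ∀ {n} {u : Fin n} {k} z → 0 < at u k z → z ≡ u
at-support {u = u} z pos with z ≟ u
at-support z pos  | yes z≡u = z≡u
at-support z ()   | no  _

at-≤ : ∀ {n} (D : Distribution n) u {w} → w ≤ D u → ∀ z → at u w z ≤ D z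
at-≤ D u w≤Du z with z ≟ u
... | yes refl = w≤Du
... | no  _    = z≤n

infixl 6 _⊕_
_⊕_ : ∀ {n} → Distribution n → Distribution n → Distribution n
(D ⊕ A) z = D z + A z

total-cong : ∀ {n} {f g : Distribution n} → (∀ z → f z ≡ g z) → total f ≡ total g
total-cong {zero}  f≗g = refl
total-cong {suc n} f≗g = cong₂ _+_ (f≗g zero) (total-cong (λ i → f≗g (suc i)))

total-⊕ : ∀ {n} (f g : Distribution n) → total (f ⊕ g) ≡ total f + total g
total-⊕ {zero}  f g = refl
total-⊕ {suc n} f g =
  trans (cong (f zero + g zero +_) (total-⊕ (λ i → f (suc i)) (λ i → g (suc i))))
        (interchange (f zero) (g zero) _ _)

total-empty : ∀ {n} → total {n} (λ _ → 0) ≡ 0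
total-empty {zero}  = refl
total-empty {suc n} = total-empty {n}

total-at : ∀ {n} (u : Fin n) k → total (at u k) ≡ k
total-at {suc n} zero    k = trans (cong (k +_) (total-empty {n})) (+-identityʳ k)
total-at {suc n} (suc u) k = trans (total-cong (at-suc u k)) (total-at u k)

entry-≤-total : ∀ {n} (A : Distribution n) z → A z ≤ total A
entry-≤-total A zero    = m≤m+n _ _
entry-≤-total A (suc z) = ≤-trans (entry-≤-total (λ i → A (suc i)) z) (m≤n+m _ (A zero))

total-remove : ∀ {n} (A : Distribution n) u {m} → m ≤ A u →
               total (λ z → A z ∸ at u m z) + m ≡ total A
total-remove A u {m} m≤Au = begin
  total rest + m                 ≡⟨ cong (total rest +_) (sym (total-at u m)) ⟩
  total rest + total (at u m)    ≡⟨ sym (total-⊕ rest (at u m)) ⟩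
  total (rest ⊕ at u m)          ≡⟨ total-cong (λ z → m∸n+n≡m (at-≤ A u m≤Au z)) ⟩
  total A                        ∎
  where
  open ≡-Reasoning
  rest = λ z → A z ∸ at u m z

total-move-≤ : ∀ {n} (A : Distribution n) u y {m} → 1 ≤ m → m ≤ A u →
               total (moveDist m u y A) ≤ total A
total-move-≤ A u y {m} 1≤m m≤Au = begin
  total (moveDist m u y A)    ≡⟨ total-⊕ rest (at y 1) ⟩
  total rest + total (at y 1) ≡⟨ cong (total rest +_) (total-at y 1) ⟩
  total rest + 1              ≤⟨ +-monoʳ-≤ (total rest) 1≤m ⟩
  total rest + m              ≡⟨ total-remove A u m≤Au ⟩
  total A                     ∎
  where
  open ≤-Reasoning
  rest = λ z → A z ∸ at u m z

infix 4 _≼_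
_≼_ : ∀ {n} → Distribution n → Distribution n → Set
V ≼ W = ∀ z → V z ≤ W z

move-mono : ∀ {n} w (u y : Fin n) {V W} → V ≼ W → moveDist w u y V ≼ moveDist w u y W
move-mono w u y V≼W z = +-monoˡ-≤ (at y 1 z) (∸-monoˡ-≤ (at u w z) (V≼W z))

add-pebble-≼ : ∀ {n} {V F : Distribution n} u → V ≼ F → V u + 1 ≤ F u → (V ⊕ at u 1) ≼ F
add-pebble-≼ u V≼F room z with z ≟ u
... | yes refl = room
... | no  _    = ≤-trans (≤-reflexive (+-identityʳ _)) (V≼F z)

reach-trans : ∀ {n} {G : WGraph n} {A B C} → Reach G A B → Reach G B C → Reach G A C
reach-trans done               B↝C = B↝C
reach-trans (step u y p l A↝B) B↝C = step u y p l (reach-trans A↝B B↝C)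

pay-move : ∀ {n} {V D A : Distribution n} u y {w} → w ≤ D u → V ≼ D ⊕ A →
           moveDist w u y V ≼ moveDist w u y D ⊕ A
pay-move {V = V} {D} {A} u y {w} w≤Du V≼D⊕A z = begin
  V z ∸ m + e             ≤⟨ +-monoˡ-≤ e (∸-monoˡ-≤ m (V≼D⊕A z)) ⟩
  (D z + A z) ∸ m + e     ≡⟨ cong (_+ e) (+-∸-comm (A z) (at-≤ D u w≤Du z)) ⟩
  D z ∸ m + A z + e       ≡⟨ xy∙z≈xz∙y (D z ∸ m) (A z) e ⟩
  D z ∸ m + e + A z       ∎
  where
  open ≤-Reasoning
  m = at u w z
  e = at y 1 z

borrow-move : ∀ {n} {V D A : Distribution n} u y {w} → D u < w → V ≼ D ⊕ A →
              moveDist w u y V ≼ D ⊕ moveDist (w ∸ D u) u y A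
borrow-move {V = V} {D} {A} u y {w} short V≼D⊕A z with z ≟ u
... | yes refl = begin
  V z ∸ w + e                  ≤⟨ +-monoˡ-≤ e (∸-monoˡ-≤ w (V≼D⊕A z)) ⟩
  (D z + A z) ∸ w + e          ≡⟨ cong (λ q → (D z + A z) ∸ q + e) (sym (m+[n∸m]≡n (<⇒≤ short))) ⟩
  (D z + A z) ∸ (D z + d) + e  ≡⟨ cong (_+ e) ([m+n]∸[m+o]≡n∸o (D z) (A z) d) ⟩
  A z ∸ d + e                  ≤⟨ m≤n+m _ (D z) ⟩
  D z + (A z ∸ d + e)          ∎
  where
  open ≤-Reasoning
  e = at y 1 z
  d = w ∸ D z
... | no _ = ≤-trans (+-monoˡ-≤ (at y 1 z) (V≼D⊕A z)) (≤-reflexive (+-assoc (D z) (A z) _))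

-- Induction on the moves: D pays when it can, otherwise A pays the shortfall,
-- and a move of positive cost never increases total A.
module Borrowing {n} (G : WGraph n) (v : Fin n) where

  borrow : ∀ {V E} → Reach G V E → ∀ {D A} → V ≼ D ⊕ A →
           ∃[ F ] (Reach G D F × E v ≤ F v + total A)
  borrow done {D} {A} V≼D⊕A =
    D , done , ≤-trans (V≼D⊕A v) (+-monoʳ-≤ (D v) (entry-≤-total A v))
  borrow (step u y pos w≤Vu r) {D} {A} V≼D⊕A with weight G u y ≤? D u
  ... | yes paid =
    let (F , D↝F , bound) = borrow r (pay-move u y paid V≼D⊕A)
    in F , step u y pos paid D↝F , bound
  ... | no unpaid =
    let short     = ≰⇒> unpaid
        owed≤Au   = m≤n+o⇒m∸n≤o _ (D u) (≤-trans w≤Vu (V≼D⊕A u))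
        A-shrinks = total-move-≤ A u y (m<n⇒0<n∸m short) owed≤Au
        (F , D↝F , bound) = borrow r (borrow-move {D = D} {A} u y short V≼D⊕A)
    in F , D↝F , ≤-trans bound (+-monoʳ-≤ (F v) A-shrinks)

spend-both : ∀ {a b c} m e → m ≤ a → a + c ≤ b → a ∸ m + e + c ≤ b ∸ m + e
spend-both {a} {b} {c} m e m≤a a+c≤b = begin
  a ∸ m + e + c   ≡⟨ xy∙z≈xz∙y (a ∸ m) e c ⟩
  a ∸ m + c + e   ≡⟨ cong (_+ e) (sym (+-∸-comm c m≤a)) ⟩
  (a + c) ∸ m + e ≤⟨ +-monoˡ-≤ e (∸-monoˡ-≤ m a+c≤b) ⟩
  b ∸ m + e       ∎
  where open ≤-Reasoning

-- Sending s pebbles from x to x' leaves (pebbles on x) + s·(pebbles on x') fixed.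
send-across : ∀ {a b s} → s ≤ a → a ∸ s + 0 + s * (b + 1) ≡ a + s * b
send-across {a} {b} {s} s≤a = begin
  a ∸ s + 0 + s * (b + 1) ≡⟨ cong₂ _+_ (+-identityʳ (a ∸ s)) (cong (s *_) (+-comm b 1)) ⟩
  a ∸ s + s * suc b       ≡⟨ cong (a ∸ s +_) (*-suc s b) ⟩
  a ∸ s + (s + s * b)     ≡⟨ sym (+-assoc (a ∸ s) s (s * b)) ⟩
  a ∸ s + s + s * b       ≡⟨ cong (_+ s * b) (m∸n+n≡m s≤a) ⟩
  a + s * b               ∎
  where open ≡-Reasoning

-- Sending s ≥ 1 pebbles back from x' to x lowers it.
send-back : ∀ {a b s} → 1 ≤ s → s ≤ b → a + 1 + s * (b ∸ s + 0) ≤ a + s * b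
send-back {a} {b} {s} 1≤s s≤b = begin
  a + 1 + s * (b ∸ s + 0) ≡⟨ cong₂ _+_ (+-comm a 1) (cong (s *_) (+-identityʳ (b ∸ s))) ⟩
  1 + a + s * (b ∸ s)     ≤⟨ +-monoˡ-≤ _ (+-monoˡ-≤ a 1≤s) ⟩
  s + a + s * (b ∸ s)     ≡⟨ cong (_+ s * (b ∸ s)) (+-comm s a) ⟩
  a + s + s * (b ∸ s)     ≡⟨ +-assoc a s _ ⟩
  a + (s + s * (b ∸ s))   ≡⟨ cong (a +_) (sym (*-suc s (b ∸ s))) ⟩
  a + s * suc (b ∸ s)     ≤⟨ +-monoʳ-≤ a (*-monoʳ-≤ s (∸-monoʳ-< 1≤s s≤b)) ⟩
  a + s * b               ∎
  where open ≤-Reasoning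

-- The borrowed debt s·a is repaid from the s·t pebbles reached on x.
repay : ∀ s t a {e f} → s * t ≤ e → e ≤ f + s * a → s * (t ∸ a) ≤ f
repay s t a {e} {f} st≤e e≤f+sa = begin
  s * (t ∸ a)       ≡⟨ *-distribˡ-∸ s t a ⟩
  s * t ∸ s * a     ≤⟨ ∸-monoˡ-≤ (s * a) (≤-trans st≤e e≤f+sa) ⟩
  f + s * a ∸ s * a ≡⟨ m+n∸n≡m f (s * a) ⟩
  f                 ∎
  where open ≤-Reasoning

restrict : ∀ {n} → Distribution (suc n) → Distribution n
restrict R i = R (suc i)

move-restrict : ∀ {n} w (u y : Fin n) (R : Distribution (suc n)) i →
                moveDist w (suc u) (suc y) R (suc i) ≡ moveDist w u y (restrict R) i
move-restrict w u y R i = cong₂ (λ p q → R (suc i) ∸ p + q) (at-suc u w i) (at-suc y 1 i)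

borrowed-total : ∀ {n} (D′ : Distribution (suc n)) x {s} → 1 ≤ s →
                 total D′ ≤ total (restrict D′ ⊕ at x (s * D′ zero))
borrowed-total D′ x {s} 1≤s = begin
  a + total D                ≡⟨ +-comm a (total D) ⟩
  total D + a                ≡⟨ cong (total D +_) (sym (*-identityˡ a)) ⟩
  total D + 1 * a            ≤⟨ +-monoʳ-≤ (total D) (*-monoˡ-≤ a 1≤s) ⟩
  total D + s * a            ≡⟨ cong (total D +_) (sym (total-at x (s * a))) ⟩
  total D + total (at x (s * a)) ≡⟨ sym (total-⊕ D (at x (s * a))) ⟩
  total (D ⊕ at x (s * a))   ∎
  where
  open ≤-Reasoning
  a = D′ zero
  D = restrict D′

module Extension {n} (G : WGraph n) (x : Fin n) (s : ℕ) (1≤s : 1 ≤ s) where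

  G' : WGraph (suc n)
  G' = extend G x s

  new-edge : weight G' (suc x) zero ≡ s
  new-edge = at-self x s

  new-edge-pos : 0 < weight G' (suc x) zero
  new-edge-pos = subst (0 <_) (sym new-edge) 1≤s

  left-on-x : ∀ R → moveDist (weight G' (suc x) zero) (suc x) zero R (suc x) ≡ R (suc x) ∸ s
  left-on-x R = trans (+-identityʳ _) (cong (R (suc x) ∸_) (trans (at-suc-self x _) new-edge))

  lift : ∀ {V E} → Reach G V E → ∀ {R} → V ≼ restrict R →
         ∃[ R′ ] (Reach G' R R′ × E ≼ restrict R′ × R zero ≤ R′ zero)
  lift done h = _ , done , h , ≤-refl
  lift {V} (step u y pos w≤Vu r) {R} h =
    let w = weight G u y
        h′ z = subst (moveDist w u y V z ≤_) (sym (move-restrict w u y R z)) (move-mono w u y h z)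
        (R′ , R↝R′ , E≼R′ , R0≤R′0) = lift r h′
    in R′ , step (suc u) (suc y) pos (≤-trans w≤Vu (h u)) R↝R′ , E≼R′ ,
       subst (_≤ R′ zero) (+-identityʳ (R zero)) R0≤R′0

  push : ∀ k {R} → s * k ≤ R (suc x) → ∃[ R′ ] (Reach G' R R′ × R zero + k ≤ R′ zero)
  push zero    _  = _ , done , ≤-reflexive (+-identityʳ _)
  push (suc k) {R} s[1+k]≤Rx =
    let s+sk≤Rx = subst (_≤ R (suc x)) (*-suc s k) s[1+k]≤Rx
        w≤Rx    = subst (_≤ R (suc x)) (sym new-edge) (m+n≤o⇒m≤o s s+sk≤Rx)
        sk≤left = subst (s * k ≤_) (sym (left-on-x R))
                    (m+n≤o⇒m≤o∸n (s * k) (subst (_≤ R (suc x)) (+-comm s (s * k)) s+sk≤Rx))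
        (R′ , R↝R′ , bound) = push k sk≤left
    in R′ , step (suc x) zero new-edge-pos w≤Rx R↝R′ ,
       subst (_≤ R′ zero) (+-assoc (R zero) 1 k) bound

  record Covers (V : Distribution (suc n)) (F : Distribution n) : Set where
    constructor covers
    field
      old : restrict V ≼ F
      hub : V (suc x) + s * V zero ≤ F x

  -- Covers is preserved by every move of G': for a move between old vertices
  -- the G-side makes the same move, for a move across the new edge nothing.
  covers-old-move : ∀ {V F} u y {w} → w ≤ V (suc u) → Covers V F →
                    Covers (moveDist w (suc u) (suc y) V) (moveDist w u y F)
  covers-old-move {V} {F} u y {w} w≤Vu (covers old hub) = covers old′ hub′
    where
    old′ : restrict (moveDist w (suc u) (suc y) V) ≼ moveDist w u y F
    old′ i = subst (_≤ moveDist w u y F i) (sym (move-restrict w u y V i)) (move-mono w u y old i)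
    hub′ : moveDist w (suc u) (suc y) V (suc x) + s * (V zero + 0) ≤ moveDist w u y F x
    hub′ = subst (_≤ moveDist w u y F x) (sym (cong₂ _+_ (move-restrict w u y V x) (cong (s *_) (+-identityʳ _))))
             (spend-both (at u w x) (at y 1 x) (at-≤ (restrict V) u w≤Vu x) hub)

  covers-send-across : ∀ {V F w} → w ≡ s → w ≤ V (suc x) → Covers V F →
                       Covers (moveDist w (suc x) zero V) F
  covers-send-across {V} {F} refl s≤Vx (covers old hub) = covers old′ hub′
    where
    old′ : restrict (moveDist s (suc x) zero V) ≼ F
    old′ i = ≤-trans (≤-reflexive (+-identityʳ _)) (≤-trans (m∸n≤m (V (suc i)) (at (suc x) s (suc i))) (old i))
    hub′ : V (suc x) ∸ at (suc x) s (suc x) + 0 + s * (V zero + 1) ≤ F x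
    hub′ = subst (λ q → V (suc x) ∸ q + 0 + s * (V zero + 1) ≤ F x) (sym (at-suc-self x s))
             (subst (_≤ F x) (sym (send-across s≤Vx)) hub)

  covers-send-back : ∀ {V F w} → w ≡ s → w ≤ V zero → Covers V F →
                     Covers (moveDist w zero (suc x) V) F
  covers-send-back {V} {F} refl s≤V0 (covers old hub) = covers old′ hub′
    where
    room : restrict V x + 1 ≤ F x
    room = ≤-trans (+-monoʳ-≤ (V (suc x)) (*-mono-≤ 1≤s (≤-trans 1≤s s≤V0))) hub
    old′ : restrict (moveDist s zero (suc x) V) ≼ F
    old′ i = subst (_≤ F i) (cong (V (suc i) +_) (sym (at-suc x 1 i)))
               (add-pebble-≼ x old room i)
    hub′ : V (suc x) + at (suc x) 1 (suc x) + s * (V zero ∸ s + 0) ≤ F x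
    hub′ = subst (λ q → V (suc x) + q + s * (V zero ∸ s + 0) ≤ F x) (sym (at-suc-self x 1))
             (≤-trans (send-back 1≤s s≤V0) hub)

  project : ∀ {V E} → Reach G' V E → ∀ {F} → Covers V F →
            ∃[ F′ ] (Reach G F F′ × Covers E F′)
  project done c = _ , done , c
  project (step zero zero () _ _) c
  project (step zero (suc j) pos w≤V0 r) c with at-support j pos
  ... | refl = project r (covers-send-back new-edge w≤V0 c)
  project (step (suc i) zero pos w≤Vx r) c with at-support i pos
  ... | refl = project r (covers-send-across new-edge w≤Vx c)
  project (step (suc i) (suc j) pos w≤Vi r) c =
    let (F′ , F↝F′ , c′) = project r (covers-old-move i j w≤Vi c)
    in F′ , step i j pos (≤-trans w≤Vi (Covers.old c i)) F↝F′ , c′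

  solvable-extend : ∀ t M → Solvable G x (s * t) M → Solvable G' newVertex t M
  solvable-extend t M solve D′ M≤D′ =
    let a = D′ zero
        D = restrict D′
        A = at x (s * a)
        M≤D⊕A = ≤-trans M≤D′ (borrowed-total D′ x 1≤s)
        (E , D⊕A↝E , st≤Ex) = solve (D ⊕ A) M≤D⊕A
        (F , D↝F , Ex≤Fx+A) = Borrowing.borrow G x D⊕A↝E (λ _ → ≤-refl)
        (R , D′↝R , F≼R , a≤R0) = lift D↝F (λ _ → ≤-refl)
        debt-paid = repay s t a st≤Ex (subst (λ q → E x ≤ F x + q) (total-at x (s * a)) Ex≤Fx+A)
        (R′ , R↝R′ , bound) = push (t ∸ a) (≤-trans debt-paid (F≼R x))
    in R′ , reach-trans D′↝R R↝R′ ,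
       ≤-trans (m≤n+m∸n t a) (≤-trans (+-monoˡ-≤ (t ∸ a) a≤R0) bound)

  solvable-restrict : ∀ t M → Solvable G' newVertex t M → Solvable G x (s * t) M
  solvable-restrict t M solve D M≤D =
    let D′ : Distribution (suc n)
        D′ = λ { zero → 0 ; (suc i) → D i }
        (E′ , D′↝E′ , t≤E′) = solve D′ M≤D
        start = covers (λ _ → ≤-refl) (≤-reflexive (trans (cong (D x +_) (*-zeroʳ s)) (+-identityʳ _)))
        (F , D↝F , c) = project D′↝E′ start
    in F , D↝F , ≤-trans (*-monoʳ-≤ s t≤E′) (≤-trans (m≤n+m _ _) (Covers.hub c))

pebbling-number-cong : ∀ {m n} {G : WGraph m} {H : WGraph n} {v w a b} →
  (∀ M → Solvable G v a M ⇔ Solvable H w b M) →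
  ∀ N → IsPebblingNumber G v a N ⇔ IsPebblingNumber H w b N
pebbling-number-cong same N =
  mk⇔ (λ (solves , least) → to (same N) solves , λ M sM → least M (from (same M) sM))
      (λ (solves , least) → from (same N) solves , λ M sM → least M (to (same M) sM))
  where open Equivalence

proposition4p5 : ∀ {n} (G : WGraph n) (s t : ℕ) → 1 ≤ s → 1 ≤ t → (x : Fin n) →
    ∀ N → IsPebblingNumber G x (s * t) N ⇔ IsPebblingNumber (extend G x s) newVertex t N
proposition4p5 G s t 1≤s _ x =
  pebbling-number-cong (λ M → mk⇔ (solvable-extend t M) (solvable-restrict t M))
  where open Extension G x s 1≤s
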